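{- Let $m,n>2$ and $\alpha\in[0,1]$. The $A_\alpha$-characteristic polynomial of $K_m\circ_2 K_n$ is \begin{multline*} \Phi(A_\alpha(K_m\circ_2 K_n),\lambda)=(\lambda-\alpha m+1)^{m-3}(\lambda-\alpha n+1)^{n-3}(\lambda-\alpha(m+n-2)+1)\\ \cdot\Big((\lambda-m+3-2\alpha)(\lambda-n+3-2\alpha)(\lambda-\alpha(m+n-4)-1)\\ -2(1-\alpha)^2\big((m+n-4)\lambda-2\alpha(m+n-4)-(m-2)(n-3)-(m-3)(n-2)\big)\Big). \end{multline*}
   Context: $K_m$ denotes the complete graph on $m$ vertices. $K_m\circ_2 K_n$ is the graph obtained by identifying an edge (a $2$-clique) of $K_m$ with an edge of $K_n$, vertex by vertex. For a graph $G$, $A_\alpha(G)=\alpha D(G)+(1-\alpha)A(G)$, where $D(G)$ is the diagonal degree matrix and $A(G)$ the adjacency matrix, and $\Phi(M,\lambda)=\det(\lambda I-M)$. -}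

module Defs where

open import Level using (Level)
open import Data.Bool using (Bool; true; false; if_then_else_; _∧_; _∨_; not)
open import Data.Nat as ℕ using (ℕ; zero; suc; _<ᵇ_; _≤ᵇ_)
open import Data.Fin using (Fin; zero; suc; toℕ; punchIn)
open import Data.Fin.Properties using (_≟_)
open import Relation.Nullary using (does)
open import Algebra.Bundles using (CommutativeRing)

Graph : ℕ → Set
Graph k = Fin k → Fin k → Bool

-- Vertex set Fin (m + n - 2): vertices 0,1 form the identified edge,
-- vertices 2..m-1 belong only to K_m, vertices m..m+n-3 belong only to K_n.
-- (For m, n ≥ 2.)
inKm : (m : ℕ) {k : ℕ} → Fin k → Bool
inKm m v = toℕ v <ᵇ m

inKn : (m : ℕ) {k : ℕ} → Fin k → Bool
inKn m v = (toℕ v <ᵇ 2) ∨ (m ≤ᵇ toℕ v)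

KmK2Kn : (m n : ℕ) → Graph (m ℕ.+ n ℕ.∸ 2)
KmK2Kn m n i j =
  not (does (i ≟ j)) ∧ ((inKm m i ∧ inKm m j) ∨ (inKn m i ∧ inKn m j))

countF : (k : ℕ) → (Fin k → Bool) → ℕ
countF zero    f = 0
countF (suc k) f = (if f zero then 1 else 0) ℕ.+ countF k (λ j → f (suc j))

degree : {k : ℕ} → Graph k → Fin k → ℕ
degree {k} G v = countF k (G v)

module _ {c ℓ : Level} (R : CommutativeRing c ℓ) where
  open CommutativeRing R hiding (zero)

  fromℕ : ℕ → Carrier
  fromℕ zero    = 0#
  fromℕ (suc n) = 1# + fromℕ n

  pow : Carrier → ℕ → Carrier
  pow x zero    = 1#
  pow x (suc n) = x * pow x n

  Matrix : ℕ → Set c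
  Matrix k = Fin k → Fin k → Carrier

  sumF : (k : ℕ) → (Fin k → Carrier) → Carrier
  sumF zero    f = 0#
  sumF (suc k) f = f zero + sumF k (λ j → f (suc j))

  sgn : {k : ℕ} → Fin k → Carrier
  sgn zero    = 1#
  sgn (suc j) = - sgn j

  det : (k : ℕ) → Matrix k → Carrier
  det zero    M = 1#
  det (suc k) M =
    sumF (suc k) (λ j → sgn j * (M zero j * det k (λ r s → M (suc r) (punchIn j s))))

  δ : {k : ℕ} → Fin k → Fin k → Carrier
  δ i j = if does (i ≟ j) then 1# else 0#

  adjMat : {k : ℕ} → Graph k → Matrix k
  adjMat G i j = if G i j then 1# else 0#

  degMat : {k : ℕ} → Graph k → Matrix k
  degMat G i j = if does (i ≟ j) then fromℕ (degree G i) else 0#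

  Aα : {k : ℕ} → Carrier → Graph k → Matrix k
  Aα α G i j = α * degMat G i j + (1# - α) * adjMat G i j

  Φ : {k : ℕ} → Matrix k → Carrier → Carrier
  Φ {k} M x = det k (λ i j → x * δ i j - M i j)

  rhs15 : (m n : ℕ) → Carrier → Carrier → Carrier
  rhs15 m n α x =
    pow (x - α * fromℕ m + 1#) (m ℕ.∸ 3)
    * pow (x - α * fromℕ n + 1#) (n ℕ.∸ 3)
    * (x - α * fromℕ (m ℕ.+ n ℕ.∸ 2) + 1#)
    * ( (x - fromℕ m + fromℕ 3 - fromℕ 2 * α)
        * (x - fromℕ n + fromℕ 3 - fromℕ 2 * α)
        * (x - α * fromℕ (m ℕ.+ n ℕ.∸ 4) - 1#)
      - fromℕ 2 * pow (1# - α) 2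
        * ( fromℕ (m ℕ.+ n ℕ.∸ 4) * x
            - fromℕ 2 * α * fromℕ (m ℕ.+ n ℕ.∸ 4)
            - fromℕ ((m ℕ.∸ 2) ℕ.* (n ℕ.∸ 3))
            - fromℕ ((m ℕ.∸ 3) ℕ.* (n ℕ.∸ 2)) ) )

-- Sort the vertices into three parts: the two ends of the shared edge, the m − 2 vertices only in
-- K_m and the n − 2 only in K_n. Vertices of one part have the same degree and the same
-- neighbours in every other part, so λI − A_α has the shape δᵢⱼ e(πᵢ) + wᵢ B(πᵢ, πⱼ) with all
-- weights wᵢ = 1. When two consecutive vertices lie in the same part, subtracting the column of one
-- from the other leaves e · (δ_p − δ_{p+1}); expanding along it shows that the determinant is e
-- times that of the matrix of the same shape in which the two vertices are merged into one of
-- weight w_p + w_{p+1}. Merging each part down to a single vertex produces the factors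
-- e(shared) e(mOnly)^{m−3} e(nOnly)^{n−3} and leaves the 3 × 3 quotient matrix, whose determinant
-- is the cubic factor.

module Submission where

open import Defs
open import Level using (Level)
open import Algebra.Bundles using (CommutativeRing)
open import Algebra.Solver.Ring.AlmostCommutativeRing using (fromCommutativeRing; _-Raw-AlmostCommutative⟶_)
open import Data.Bool using (Bool; true; false; if_then_else_; _∧_; _∨_; not)
open import Data.Empty using (⊥-elim)
open import Data.Fin as Fin using (Fin; zero; suc; toℕ; punchIn; punchOut; inject₁)
open import Data.Fin.Properties using (suc-injective; punchIn-injective; punchInᵢ≢i; punchIn-punchOut)
open import Data.Integer as ℤ using (ℤ; -[1+_]; _⊖_)
import Data.Integer.Properties as ℤ
open import Data.Maybe using (Maybe; just; nothing)
open import Data.Nat as ℕ using (ℕ; zero; suc; _<_; s≤s; z≤n; _<ᵇ_; _≤ᵇ_)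
import Data.Nat.Properties as ℕ
open import Data.Product using (∃; _×_; _,_)
open import Function using (_∘_)
open import Relation.Nullary using (does; yes; no)
open import Relation.Binary.PropositionalEquality as ≡ using (_≡_; _≢_)

punchIn-inject₁-self : ∀ {k} (p : Fin (suc k)) → punchIn (inject₁ p) p ≡ suc p
punchIn-inject₁-self zero = ≡.refl
punchIn-inject₁-self {suc k} (suc p) = ≡.cong suc (punchIn-inject₁-self p)

punchIn-suc-self : ∀ {k} (p : Fin (suc k)) → punchIn (suc p) p ≡ inject₁ p
punchIn-suc-self zero = ≡.refl
punchIn-suc-self {suc k} (suc p) = ≡.cong suc (punchIn-suc-self p)

punchIn-inject₁≡punchIn-suc : ∀ {k} (p s : Fin (suc k)) → s ≢ p → punchIn (inject₁ p) s ≡ punchIn (suc p) s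
punchIn-inject₁≡punchIn-suc zero zero s≢p = ⊥-elim (s≢p ≡.refl)
punchIn-inject₁≡punchIn-suc zero (suc s) _ = ≡.refl
punchIn-inject₁≡punchIn-suc {suc k} (suc p) zero _ = ≡.refl
punchIn-inject₁≡punchIn-suc {suc k} (suc p) (suc s) s≢p =
  ≡.cong suc (punchIn-inject₁≡punchIn-suc p s (s≢p ∘ ≡.cong suc))

punchIn-adjacent : ∀ {k} (j : Fin (suc (suc k))) (p : Fin (suc k)) → j ≢ inject₁ p → j ≢ suc p →
                   ∃ λ (q : Fin k) → punchIn j (inject₁ q) ≡ inject₁ p × punchIn j (suc q) ≡ suc p
punchIn-adjacent zero zero j≢p _ = ⊥-elim (j≢p ≡.refl)
punchIn-adjacent {suc k} zero (suc p) _ _ = p , ≡.refl , ≡.refl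
punchIn-adjacent (suc zero) zero _ j≢p+1 = ⊥-elim (j≢p+1 ≡.refl)
punchIn-adjacent {suc k} (suc (suc j)) zero _ _ = zero , ≡.refl , ≡.refl
punchIn-adjacent {suc k} (suc j) (suc p) j≢p j≢p+1 with punchIn-adjacent j p (j≢p ∘ ≡.cong suc) (j≢p+1 ∘ ≡.cong suc)
... | q , e₁ , e₂ = suc q , ≡.cong suc e₁ , ≡.cong suc e₂

punchIn-punchIn-comm : ∀ {k} (p : Fin (suc (suc k))) (j q : Fin (suc k)) → punchIn (punchIn p j) q ≡ p →
                       ∀ b → punchIn (punchIn p j) (punchIn q b) ≡ punchIn p (punchIn j b)
punchIn-punchIn-comm zero j zero e b = ≡.refl
punchIn-punchIn-comm {suc k} zero j (suc q) () b
punchIn-punchIn-comm (suc p) zero q ≡.refl b = ≡.refl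
punchIn-punchIn-comm {suc k} (suc p) (suc j) zero () b
punchIn-punchIn-comm {suc k} (suc p) (suc j) (suc q) e zero = ≡.refl
punchIn-punchIn-comm {suc k} (suc p) (suc j) (suc q) e (suc b) = ≡.cong suc (punchIn-punchIn-comm p j q (suc-injective e) b)

_◃_ : ∀ {a} {A : Set a} → A → (ℕ → A) → ℕ → A
(x ◃ f) zero = x
(x ◃ f) (suc n) = f n

infixr 5 _◃_

data Part : Set where
  shared mOnly nOnly : Part

inKmᴾ inKnᴾ : Part → Bool
inKmᴾ shared = true
inKmᴾ mOnly = true
inKmᴾ nOnly = false
inKnᴾ shared = true
inKnᴾ mOnly = false
inKnᴾ nOnly = true

adjacentParts : Part → Part → Bool
adjacentParts π ρ = (inKmᴾ π ∧ inKmᴾ ρ) ∨ (inKnᴾ π ∧ inKnᴾ ρ)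

adjacentParts-refl : ∀ π → adjacentParts π π ≡ true
adjacentParts-refl shared = ≡.refl
adjacentParts-refl mOnly = ≡.refl
adjacentParts-refl nOnly = ≡.refl

-- With m = a + 3, KmK2Kn numbers the vertices of K_m ∘₂ K_n as: the shared edge 0, 1, then the
-- a + 1 vertices of K_m only, then those of K_n only. Vertex t + 2 lies in offEdgePart a t.
offEdgePart : ℕ → ℕ → Part
offEdgePart a zero = mOnly
offEdgePart zero (suc t) = nOnly
offEdgePart (suc a) (suc t) = offEdgePart a t

contractedPart : ℕ → ℕ → Part
contractedPart a = shared ◃ offEdgePart a

vertexPart : ℕ → ℕ → Part
vertexPart a = shared ◃ contractedPart a

partDegree : ℕ → ℕ → Part → ℕ
partDegree a b shared = a ℕ.+ suc (suc (suc b))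
partDegree a b mOnly = suc (suc a)
partDegree a b nOnly = suc (suc b)

inKm-offEdgePart : ∀ a t → (t <ᵇ suc a) ≡ inKmᴾ (offEdgePart a t)
inKm-offEdgePart a zero = ≡.refl
inKm-offEdgePart zero (suc t) = ≡.refl
inKm-offEdgePart (suc a) (suc t) = inKm-offEdgePart a t

inKn-offEdgePart : ∀ a t → (a <ᵇ t) ≡ inKnᴾ (offEdgePart a t)
inKn-offEdgePart a zero = ≡.refl
inKn-offEdgePart zero (suc t) = ≡.refl
inKn-offEdgePart (suc a) (suc t) = inKn-offEdgePart a t

inKm-vertexPart : ∀ a t → (t <ᵇ suc (suc (suc a))) ≡ inKmᴾ (vertexPart a t)
inKm-vertexPart a zero = ≡.refl
inKm-vertexPart a (suc zero) = ≡.refl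
inKm-vertexPart a (suc (suc t)) = inKm-offEdgePart a t

inKn-vertexPart : ∀ a t → ((t <ᵇ 2) ∨ (suc (suc (suc a)) ≤ᵇ t)) ≡ inKnᴾ (vertexPart a t)
inKn-vertexPart a zero = ≡.refl
inKn-vertexPart a (suc zero) = ≡.refl
inKn-vertexPart a (suc (suc t)) = inKn-offEdgePart a t

commonClique≡adjacentParts : ∀ a {k} (i j : Fin k) →
  (inKm (suc (suc (suc a))) i ∧ inKm (suc (suc (suc a))) j) ∨ (inKn (suc (suc (suc a))) i ∧ inKn (suc (suc (suc a))) j)
    ≡ adjacentParts (vertexPart a (toℕ i)) (vertexPart a (toℕ j))
commonClique≡adjacentParts a i j
  rewrite inKm-vertexPart a (toℕ i) | inKm-vertexPart a (toℕ j)
        | inKn-vertexPart a (toℕ i) | inKn-vertexPart a (toℕ j) = ≡.refl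

countBelow : ℕ → (ℕ → Bool) → ℕ
countBelow zero h = 0
countBelow (suc k) h = (if h zero then 1 else 0) ℕ.+ countBelow k (h ∘ suc)

countF-cong : ∀ k {f g : Fin k → Bool} → (∀ j → f j ≡ g j) → countF k f ≡ countF k g
countF-cong zero f≗g = ≡.refl
countF-cong (suc k) f≗g =
  ≡.cong₂ ℕ._+_ (≡.cong (λ b → if b then 1 else 0) (f≗g zero)) (countF-cong k (f≗g ∘ suc))

countBelow-cong : ∀ k {f g : ℕ → Bool} → (∀ t → f t ≡ g t) → countBelow k f ≡ countBelow k g
countBelow-cong zero f≗g = ≡.refl
countBelow-cong (suc k) f≗g =
  ≡.cong₂ ℕ._+_ (≡.cong (λ b → if b then 1 else 0) (f≗g zero)) (countBelow-cong k (f≗g ∘ suc))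

countF-toℕ : ∀ k (h : ℕ → Bool) → countF k (h ∘ toℕ) ≡ countBelow k h
countF-toℕ zero h = ≡.refl
countF-toℕ (suc k) h = ≡.cong ((if h zero then 1 else 0) ℕ.+_) (countF-toℕ k (h ∘ suc))

countF-others : ∀ k (f : Fin k → Bool) (i : Fin k) → f i ≡ true →
                suc (countF k (λ j → not (does (i Fin.≟ j)) ∧ f j)) ≡ countF k f
countF-others (suc k) f zero fi rewrite fi = ≡.refl
countF-others (suc k) f (suc i) fi =
  ≡.trans (≡.sym (ℕ.+-suc (if f zero then 1 else 0) _))
          (≡.cong ((if f zero then 1 else 0) ℕ.+_) (countF-others k (f ∘ suc) i fi))

countBelow-true : ∀ k → countBelow k (λ _ → true) ≡ k
countBelow-true zero = ≡.refl
countBelow-true (suc k) = ≡.cong suc (countBelow-true k)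

countBelow-false : ∀ k → countBelow k (λ _ → false) ≡ 0
countBelow-false zero = ≡.refl
countBelow-false (suc k) = countBelow-false k

countBelow-inKm-offEdgePart : ∀ a b → countBelow (suc a ℕ.+ suc b) (inKmᴾ ∘ offEdgePart a) ≡ suc a
countBelow-inKm-offEdgePart zero b = ≡.cong suc (countBelow-false b)
countBelow-inKm-offEdgePart (suc a) b = ≡.cong suc (countBelow-inKm-offEdgePart a b)

countBelow-inKn-offEdgePart : ∀ a b → countBelow (suc a ℕ.+ suc b) (inKnᴾ ∘ offEdgePart a) ≡ suc b
countBelow-inKn-offEdgePart zero b = ≡.cong suc (countBelow-true b)
countBelow-inKn-offEdgePart (suc a) b = countBelow-inKn-offEdgePart a b

countBelow-adjacentParts : ∀ a b π →
  countBelow (suc (a ℕ.+ suc (suc (suc b)))) (adjacentParts π ∘ vertexPart a) ≡ suc (partDegree a b π)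
countBelow-adjacentParts a b shared =
  ≡.trans (countBelow-cong (suc (a ℕ.+ suc (suc (suc b)))) (sharedAdjacent ∘ vertexPart a)) (countBelow-true _)
  where
  sharedAdjacent : ∀ π → adjacentParts shared π ≡ true
  sharedAdjacent shared = ≡.refl
  sharedAdjacent mOnly = ≡.refl
  sharedAdjacent nOnly = ≡.refl
countBelow-adjacentParts a b mOnly rewrite ℕ.+-suc a (suc (suc b)) | ℕ.+-suc a (suc b) =
  ≡.trans (countBelow-cong (suc (suc (suc (a ℕ.+ suc b)))) (mOnlyAdjacent ∘ vertexPart a))
          (≡.cong (ℕ.suc ∘ ℕ.suc) (countBelow-inKm-offEdgePart a b))
  where
  mOnlyAdjacent : ∀ π → adjacentParts mOnly π ≡ inKmᴾ π
  mOnlyAdjacent shared = ≡.refl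
  mOnlyAdjacent mOnly = ≡.refl
  mOnlyAdjacent nOnly = ≡.refl
countBelow-adjacentParts a b nOnly rewrite ℕ.+-suc a (suc (suc b)) | ℕ.+-suc a (suc b) =
  ≡.trans (countBelow-cong (suc (suc (suc (a ℕ.+ suc b)))) (nOnlyAdjacent ∘ vertexPart a))
          (≡.cong (ℕ.suc ∘ ℕ.suc) (countBelow-inKn-offEdgePart a b))
  where
  nOnlyAdjacent : ∀ π → adjacentParts nOnly π ≡ inKnᴾ π
  nOnlyAdjacent shared = ≡.refl
  nOnlyAdjacent mOnly = ≡.refl
  nOnlyAdjacent nOnly = ≡.refl

degree-KmK2Kn : ∀ a b (i : Fin (suc (a ℕ.+ suc (suc (suc b))))) →
  degree (KmK2Kn (suc (suc (suc a))) (suc (suc (suc b)))) i ≡ partDegree a b (vertexPart a (toℕ i))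
degree-KmK2Kn a b i = ℕ.suc-injective (begin
  suc (countF k (KmK2Kn (3 ℕ.+ a) (3 ℕ.+ b) i))
    ≡⟨ ≡.cong suc (countF-cong k (λ j → ≡.cong (not (does (i Fin.≟ j)) ∧_) (commonClique≡adjacentParts a i j))) ⟩
  suc (countF k (λ j → not (does (i Fin.≟ j)) ∧ neighbour (toℕ j)))   ≡⟨ countF-others k (neighbour ∘ toℕ) i (adjacentParts-refl π) ⟩
  countF k (neighbour ∘ toℕ)                                          ≡⟨ countF-toℕ k neighbour ⟩
  countBelow k neighbour                                              ≡⟨ countBelow-adjacentParts a b π ⟩
  suc (partDegree a b π)                                              ∎)
  where
  open ≡.≡-Reasoning
  k : ℕ
  k = suc (a ℕ.+ suc (suc (suc b)))
  π : Part
  π = vertexPart a (toℕ i)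
  neighbour : ℕ → Bool
  neighbour = adjacentParts π ∘ vertexPart a

module _ {c ℓ : Level} (R : CommutativeRing c ℓ) where
  open CommutativeRing R hiding (zero)
  open import Algebra.Properties.Ring ring using (-‿involutive; -‿distribʳ-*; -‿+-comm; -0#≈0#; xyx⁻¹≈y)
  open import Algebra.Properties.Semiring.Sum semiring using (sum; sum-cong-≋; ∑-distrib-+; *-distribˡ-sum; sum-remove; sum-replicate-zero)
  open import Algebra.Properties.Semiring.Mult.TCOptimised semiring using (1+×; ×-homo-+) renaming (_×_ to _·_)
  open import Relation.Binary.Reasoning.Setoid setoid

  fromℕ-+ : ∀ m n → fromℕ R (m ℕ.+ n) ≈ fromℕ R m + fromℕ R n
  fromℕ-+ zero n = sym (+-identityˡ _)
  fromℕ-+ (suc m) n = trans (+-congˡ (fromℕ-+ m n)) (sym (+-assoc _ _ _))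

  fromℕ-* : ∀ m n → fromℕ R (m ℕ.* n) ≈ fromℕ R m * fromℕ R n
  fromℕ-* zero n = sym (zeroˡ _)
  fromℕ-* (suc m) n = begin
    fromℕ R (n ℕ.+ m ℕ.* n)              ≈⟨ fromℕ-+ n (m ℕ.* n) ⟩
    fromℕ R n + fromℕ R (m ℕ.* n)        ≈⟨ +-cong (sym (*-identityˡ _)) (fromℕ-* m n) ⟩
    1# * fromℕ R n + fromℕ R m * fromℕ R n ≈⟨ distribʳ _ _ _ ⟨
    (1# + fromℕ R m) * fromℕ R n         ∎

  [x+y]-[x+z]≈y-z : ∀ x y z → (x + y) - (x + z) ≈ y - z
  [x+y]-[x+z]≈y-z x y z = begin
    (x + y) - (x + z)     ≈⟨ +-congˡ (-‿+-comm x z) ⟨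
    (x + y) + (- x - z)   ≈⟨ +-assoc (x + y) (- x) (- z) ⟨
    (x + y - x) - z       ≈⟨ +-congʳ (xyx⁻¹≈y x y) ⟩
    y - z                 ∎

  -- The optimised multiplication has 1 · x = x, so the solver's constant con (+ 1) is 1# definitionally.
  fromℤ : ℤ → Carrier
  fromℤ (ℤ.+ n) = n · 1#
  fromℤ -[1+ n ] = - (suc n · 1#)

  fromℤ-⊖ : ∀ m n → fromℤ (m ⊖ n) ≈ m · 1# - n · 1#
  fromℤ-⊖ zero zero = sym (-‿inverseʳ 0#)
  fromℤ-⊖ (suc m) zero = sym (trans (+-congˡ -0#≈0#) (+-identityʳ _))
  fromℤ-⊖ zero (suc n) = sym (+-identityˡ _)
  fromℤ-⊖ (suc m) (suc n) = begin
    fromℤ (suc m ⊖ suc n)                 ≡⟨ ≡.cong fromℤ (ℤ.[1+m]⊖[1+n]≡m⊖n m n) ⟩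
    fromℤ (m ⊖ n)                         ≈⟨ fromℤ-⊖ m n ⟩
    m · 1# - n · 1#                       ≈⟨ [x+y]-[x+z]≈y-z 1# _ _ ⟨
    (1# + m · 1#) - (1# + n · 1#)         ≈⟨ +-cong (1+× m 1#) (-‿cong (1+× n 1#)) ⟨
    suc m · 1# - suc n · 1#               ∎

  fromℤ-neg : ∀ i → fromℤ (ℤ.- i) ≈ - fromℤ i
  fromℤ-neg (ℤ.+ zero) = sym -0#≈0#
  fromℤ-neg (ℤ.+ suc n) = refl
  fromℤ-neg -[1+ n ] = sym (-‿involutive _)

  fromℤ-+ : ∀ i j → fromℤ (i ℤ.+ j) ≈ fromℤ i + fromℤ j
  fromℤ-+ -[1+ m ] -[1+ n ] = begin
    - (suc (suc (m ℕ.+ n)) · 1#)           ≡⟨ ≡.cong (λ k → - (suc k · 1#)) (ℕ.+-suc m n) ⟨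
    - ((suc m ℕ.+ suc n) · 1#)             ≈⟨ -‿cong (×-homo-+ 1# (suc m) (suc n)) ⟩
    - (suc m · 1# + suc n · 1#)            ≈⟨ -‿+-comm _ _ ⟨
    - (suc m · 1#) + - (suc n · 1#)        ∎
  fromℤ-+ -[1+ m ] (ℤ.+ n) = trans (fromℤ-⊖ n (suc m)) (+-comm _ _)
  fromℤ-+ (ℤ.+ m) -[1+ n ] = fromℤ-⊖ m (suc n)
  fromℤ-+ (ℤ.+ m) (ℤ.+ n) = ×-homo-+ 1# m n

  fromℤ-*-+ : ∀ i n → fromℤ (i ℤ.* ℤ.+ n) ≈ fromℤ i * (n · 1#)
  fromℤ-*-+ i zero = begin
    fromℤ (i ℤ.* ℤ.+ 0)  ≡⟨ ≡.cong fromℤ (ℤ.*-zeroʳ i) ⟩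
    0#                   ≈⟨ zeroʳ _ ⟨
    fromℤ i * 0#         ∎
  fromℤ-*-+ i (suc n) = begin
    fromℤ (i ℤ.* ℤ.+ suc n)               ≡⟨ ≡.cong fromℤ (ℤ.*-suc i (ℤ.+ n)) ⟩
    fromℤ (i ℤ.+ i ℤ.* ℤ.+ n)             ≈⟨ fromℤ-+ i (i ℤ.* ℤ.+ n) ⟩
    fromℤ i + fromℤ (i ℤ.* ℤ.+ n)         ≈⟨ +-cong (sym (*-identityʳ _)) (fromℤ-*-+ i n) ⟩
    fromℤ i * 1# + fromℤ i * (n · 1#)       ≈⟨ distribˡ _ _ _ ⟨
    fromℤ i * (1# + n · 1#)               ≈⟨ *-congˡ (1+× n 1#) ⟨
    fromℤ i * (suc n · 1#)                  ∎

  fromℤ-* : ∀ i j → fromℤ (i ℤ.* j) ≈ fromℤ i * fromℤ j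
  fromℤ-* i (ℤ.+ n) = fromℤ-*-+ i n
  fromℤ-* i -[1+ n ] = begin
    fromℤ (i ℤ.* -[1+ n ])               ≡⟨ ≡.cong fromℤ (ℤ.neg-distribʳ-* i (ℤ.+ suc n)) ⟨
    fromℤ (ℤ.- (i ℤ.* ℤ.+ suc n))        ≈⟨ fromℤ-neg (i ℤ.* ℤ.+ suc n) ⟩
    - fromℤ (i ℤ.* ℤ.+ suc n)            ≈⟨ -‿cong (fromℤ-*-+ i (suc n)) ⟩
    - (fromℤ i * (suc n · 1#))             ≈⟨ -‿distribʳ-* _ _ ⟩
    fromℤ i * - (suc n · 1#)             ∎

  fromℤ-homomorphism : CommutativeRing.rawRing ℤ.+-*-commutativeRing -Raw-AlmostCommutative⟶ fromCommutativeRing R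
  fromℤ-homomorphism = record
    { ⟦_⟧ = fromℤ ; +-homo = fromℤ-+ ; *-homo = fromℤ-* ; -‿homo = fromℤ-neg
    ; 0-homo = refl ; 1-homo = refl }

  fromℤ-≟ : ∀ i j → Maybe (fromℤ i ≈ fromℤ j)
  fromℤ-≟ i j with i ℤ.≟ j
  ... | yes ≡.refl = just refl
  ... | no _ = nothing

  open import Algebra.Solver.Ring (CommutativeRing.rawRing ℤ.+-*-commutativeRing) (fromCommutativeRing R) fromℤ-homomorphism fromℤ-≟
    using (solve; _:+_; _:*_; _:-_; :-_; _:=_; con; Polynomial)

  1ᴾ 0ᴾ : ∀ {n} → Polynomial n
  1ᴾ = con (ℤ.+ 1)
  0ᴾ = con (ℤ.+ 0)

  sumF≡sum : ∀ k (f : Fin k → Carrier) → sumF R k f ≡ sum f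
  sumF≡sum zero f = ≡.refl
  sumF≡sum (suc k) f = ≡.cong (f zero +_) (sumF≡sum k (f ∘ suc))

  sumF-cong : ∀ k {f g : Fin k → Carrier} → (∀ j → f j ≈ g j) → sumF R k f ≈ sumF R k g
  sumF-cong k {f} {g} f≈g = begin
    sumF R k f  ≡⟨ sumF≡sum k f ⟩
    sum f       ≈⟨ sum-cong-≋ f≈g ⟩
    sum g       ≡⟨ sumF≡sum k g ⟨
    sumF R k g  ∎

  sumF-linear : ∀ k a b (f g : Fin k → Carrier) →
                sumF R k (λ j → a * f j + b * g j) ≈ a * sumF R k f + b * sumF R k g
  sumF-linear k a b f g = begin
    sumF R k (λ j → a * f j + b * g j)               ≡⟨ sumF≡sum k _ ⟩
    sum (λ j → a * f j + b * g j)                    ≈⟨ ∑-distrib-+ (λ j → a * f j) (λ j → b * g j) ⟩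
    sum (λ j → a * f j) + sum (λ j → b * g j)        ≈⟨ +-cong (*-distribˡ-sum a f) (*-distribˡ-sum b g) ⟨
    a * sum f + b * sum g                            ≡⟨ ≡.cong₂ (λ s t → a * s + b * t) (sumF≡sum k f) (sumF≡sum k g) ⟨
    a * sumF R k f + b * sumF R k g                  ∎

  sumF-scale : ∀ k a (f : Fin k → Carrier) → sumF R k (λ j → a * f j) ≈ a * sumF R k f
  sumF-scale k a f = begin
    sumF R k (λ j → a * f j)  ≡⟨ sumF≡sum k _ ⟩
    sum (λ j → a * f j)       ≈⟨ *-distribˡ-sum a f ⟨
    a * sum f                 ≡⟨ ≡.cong (a *_) (sumF≡sum k f) ⟨
    a * sumF R k f            ∎

  sumF-remove : ∀ k (f : Fin (suc k) → Carrier) p → sumF R (suc k) f ≈ f p + sumF R k (f ∘ punchIn p)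
  sumF-remove k f p = begin
    sumF R (suc k) f              ≡⟨ sumF≡sum (suc k) f ⟩
    sum f                         ≈⟨ sum-remove f ⟩
    f p + sum (f ∘ punchIn p)     ≡⟨ ≡.cong (f p +_) (sumF≡sum k (f ∘ punchIn p)) ⟨
    f p + sumF R k (f ∘ punchIn p) ∎

  sumF-zero : ∀ k (f : Fin k → Carrier) → (∀ j → f j ≈ 0#) → sumF R k f ≈ 0#
  sumF-zero k f f≈0 = begin
    sumF R k f         ≈⟨ sumF-cong k f≈0 ⟩
    sumF R k (λ _ → 0#) ≡⟨ sumF≡sum k _ ⟩
    sum {k} (λ _ → 0#) ≈⟨ sum-replicate-zero k ⟩
    0#                 ∎

  minor : ∀ {k} → Matrix R (suc k) → Fin (suc k) → Fin (suc k) → Matrix R k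
  minor M r p a b = M (punchIn r a) (punchIn p b)

  laplaceTerm : ∀ {k} → Matrix R (suc k) → Fin (suc k) → Carrier
  laplaceTerm {k} M j = sgn R j * (M zero j * det R k (minor M zero j))

  det-cong : ∀ k {M N : Matrix R k} → (∀ i j → M i j ≈ N i j) → det R k M ≈ det R k N
  det-cong zero M≈N = refl
  det-cong (suc k) {M} {N} M≈N =
    sumF-cong (suc k) {laplaceTerm M} {laplaceTerm N} (λ j → *-congˡ (*-cong (M≈N zero j) (det-cong k (λ a b → M≈N (suc a) (punchIn j b)))))

  laplaceTerm-linear-entry : ∀ {k} (M N Q : Matrix R (suc k)) j a b →
    M zero j ≈ a * N zero j + b * Q zero j →
    (∀ x y → minor M zero j x y ≈ minor N zero j x y) → (∀ x y → minor M zero j x y ≈ minor Q zero j x y) →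
    laplaceTerm M j ≈ a * laplaceTerm N j + b * laplaceTerm Q j
  laplaceTerm-linear-entry {k} M N Q j a b M₀≈ M≈N M≈Q = begin
    sgn R j * (M zero j * det R k (minor M zero j))                       ≈⟨ *-congˡ (*-cong M₀≈ (det-cong k M≈N)) ⟩
    sgn R j * ((a * N zero j + b * Q zero j) * det R k (minor N zero j))   ≈⟨ distribute _ _ _ _ _ _ ⟩
    a * laplaceTerm N j + b * (sgn R j * (Q zero j * det R k (minor N zero j)))
      ≈⟨ +-congˡ (*-congˡ (*-congˡ (*-congˡ (det-cong k (λ x y → trans (sym (M≈N x y)) (M≈Q x y)))))) ⟩
    a * laplaceTerm N j + b * laplaceTerm Q j                             ∎
    where
    distribute : ∀ s a b n q d → s * ((a * n + b * q) * d) ≈ a * (s * (n * d)) + b * (s * (q * d))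
    distribute = solve 6 (λ s a b n q d → s :* ((a :* n :+ b :* q) :* d) := a :* (s :* (n :* d)) :+ b :* (s :* (q :* d))) refl

  laplaceTerm-linear-minor : ∀ {k} (M N Q : Matrix R (suc k)) j a b →
    M zero j ≈ N zero j → M zero j ≈ Q zero j →
    det R k (minor M zero j) ≈ a * det R k (minor N zero j) + b * det R k (minor Q zero j) →
    laplaceTerm M j ≈ a * laplaceTerm N j + b * laplaceTerm Q j
  laplaceTerm-linear-minor {k} M N Q j a b M₀≈N₀ M₀≈Q₀ minor≈ = begin
    sgn R j * (M zero j * det R k (minor M zero j))                                    ≈⟨ *-congˡ (*-congˡ minor≈) ⟩
    sgn R j * (M zero j * (a * det R k (minor N zero j) + b * det R k (minor Q zero j))) ≈⟨ distribute _ _ _ _ _ _ ⟩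
    a * (sgn R j * (M zero j * det R k (minor N zero j))) + b * (sgn R j * (M zero j * det R k (minor Q zero j)))
      ≈⟨ +-cong (*-congˡ (*-congˡ (*-congʳ M₀≈N₀))) (*-congˡ (*-congˡ (*-congʳ M₀≈Q₀))) ⟩
    a * laplaceTerm N j + b * laplaceTerm Q j                                          ∎
    where
    distribute : ∀ s m a b dn dq → s * (m * (a * dn + b * dq)) ≈ a * (s * (m * dn)) + b * (s * (m * dq))
    distribute = solve 6 (λ s m a b dn dq → s :* (m :* (a :* dn :+ b :* dq)) := a :* (s :* (m :* dn)) :+ b :* (s :* (m :* dq))) refl

  det-linear-row : ∀ k (M N Q : Matrix R k) r a b →
    (∀ i j → i ≢ r → M i j ≈ N i j) → (∀ i j → i ≢ r → M i j ≈ Q i j) →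
    (∀ j → M r j ≈ a * N r j + b * Q r j) → det R k M ≈ a * det R k N + b * det R k Q
  det-linear-row (suc k) M N Q zero a b M≈N M≈Q Mr≈ =
    trans (sumF-cong (suc k) termwise) (sumF-linear (suc k) a b (laplaceTerm N) (laplaceTerm Q))
    where
    termwise : ∀ j → laplaceTerm M j ≈ a * laplaceTerm N j + b * laplaceTerm Q j
    termwise j = laplaceTerm-linear-entry M N Q j a b (Mr≈ j) (λ x y → M≈N (suc x) _ (λ ())) (λ x y → M≈Q (suc x) _ (λ ()))
  det-linear-row (suc k) M N Q (suc r) a b M≈N M≈Q Mr≈ =
    trans (sumF-cong (suc k) termwise) (sumF-linear (suc k) a b (laplaceTerm N) (laplaceTerm Q))
    where
    termwise : ∀ j → laplaceTerm M j ≈ a * laplaceTerm N j + b * laplaceTerm Q j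
    termwise j = laplaceTerm-linear-minor M N Q j a b (M≈N zero j (λ ())) (M≈Q zero j (λ ()))
      (det-linear-row k (minor M zero j) (minor N zero j) (minor Q zero j) r a b
        (λ x y x≢r → M≈N (suc x) _ (x≢r ∘ suc-injective)) (λ x y x≢r → M≈Q (suc x) _ (x≢r ∘ suc-injective)) (λ y → Mr≈ _))

  det-linear-column : ∀ k (M N Q : Matrix R k) p a b →
    (∀ i j → j ≢ p → M i j ≈ N i j) → (∀ i j → j ≢ p → M i j ≈ Q i j) →
    (∀ i → M i p ≈ a * N i p + b * Q i p) → det R k M ≈ a * det R k N + b * det R k Q
  det-linear-column (suc k) M N Q p a b M≈N M≈Q Mp≈ =
    trans (sumF-cong (suc k) termwise) (sumF-linear (suc k) a b (laplaceTerm N) (laplaceTerm Q))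
    where
    termwise : ∀ j → laplaceTerm M j ≈ a * laplaceTerm N j + b * laplaceTerm Q j
    termwise j with j Fin.≟ p
    ... | yes ≡.refl = laplaceTerm-linear-entry M N Q j a b (Mp≈ zero)
                         (λ x y → M≈N (suc x) _ (punchInᵢ≢i j y)) (λ x y → M≈Q (suc x) _ (punchInᵢ≢i j y))
    ... | no j≢p = laplaceTerm-linear-minor M N Q j a b (M≈N zero j j≢p) (M≈Q zero j j≢p)
                     (det-linear-column k (minor M zero j) (minor N zero j) (minor Q zero j) q a b
                       (λ x y y≢q → M≈N (suc x) _ (avoids y y≢q)) (λ x y y≢q → M≈Q (suc x) _ (avoids y y≢q))
                       (λ x → ≡.subst (λ z → M (suc x) z ≈ a * N (suc x) z + b * Q (suc x) z)
                                      (≡.sym (punchIn-punchOut j≢p)) (Mp≈ (suc x))))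
      where
      q : Fin k
      q = punchOut j≢p
      avoids : ∀ y → y ≢ q → punchIn j y ≢ p
      avoids y y≢q e = y≢q (punchIn-injective j y q (≡.trans e (≡.sym (punchIn-punchOut j≢p))))

  det-zero-column : ∀ k (M : Matrix R k) p → (∀ i → M i p ≈ 0#) → det R k M ≈ 0#
  det-zero-column k M p Mp≈0 = begin
    det R k M                         ≈⟨ det-linear-column k M M M p 0# 0# (λ _ _ _ → refl) (λ _ _ _ → refl)
                                                           (λ i → trans (Mp≈0 i) (0≈0x+0x _)) ⟩
    0# * det R k M + 0# * det R k M   ≈⟨ 0≈0x+0x _ ⟨
    0#                                ∎
    where
    0≈0x+0x : ∀ x → 0# ≈ 0# * x + 0# * x
    0≈0x+0x = solve 1 (λ x → 0ᴾ := 0ᴾ :* x :+ 0ᴾ :* x) refl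

  sumF-pair : ∀ k (f : Fin (suc (suc k)) → Carrier) c d → c ≢ d → f c + f d ≈ 0# →
              (∀ j → j ≢ c → j ≢ d → f j ≈ 0#) → sumF R (suc (suc k)) f ≈ 0#
  sumF-pair k f c d c≢d fc+fd≈0 others≈0 = begin
    sumF R (suc (suc k)) f                                    ≈⟨ sumF-remove (suc k) f c ⟩
    f c + sumF R (suc k) (f ∘ punchIn c)                      ≈⟨ +-congˡ (sumF-remove k (f ∘ punchIn c) d′) ⟩
    f c + (f (punchIn c d′) + sumF R k (f ∘ punchIn c ∘ punchIn d′))
      ≈⟨ +-congˡ (+-cong (reflexive (≡.cong f (punchIn-punchOut c≢d))) (sumF-zero k _ rest≈0)) ⟩
    f c + (f d + 0#)                                          ≈⟨ trans (+-congˡ (+-identityʳ _)) fc+fd≈0 ⟩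
    0#                                                        ∎
    where
    d′ : Fin (suc k)
    d′ = punchOut c≢d
    rest≈0 : ∀ j → f (punchIn c (punchIn d′ j)) ≈ 0#
    rest≈0 j = others≈0 _ (punchInᵢ≢i c _)
      (λ e → punchInᵢ≢i d′ j (punchIn-injective c _ _ (≡.trans e (≡.sym (punchIn-punchOut c≢d)))))

  sgn-inject₁ : ∀ {k} (p : Fin k) → sgn R (inject₁ p) ≡ sgn R p
  sgn-inject₁ zero = ≡.refl
  sgn-inject₁ (suc p) = ≡.cong -_ (sgn-inject₁ p)

  det-adjacent-equal-columns : ∀ k (M : Matrix R (suc k)) (p : Fin k) →
    (∀ i → M i (inject₁ p) ≈ M i (suc p)) → det R (suc k) M ≈ 0#
  det-adjacent-equal-columns (suc k) M p Mp≈Mp+1 = sumF-pair k (laplaceTerm M) (inject₁ p) (suc p) p≢p+1 cancel others≈0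
    where
    p≢p+1 : inject₁ p ≢ suc p
    p≢p+1 e = punchInᵢ≢i (inject₁ p) p (≡.trans (punchIn-inject₁-self p) (≡.sym e))
    minors≈ : ∀ x y → minor M zero (inject₁ p) x y ≈ minor M zero (suc p) x y
    minors≈ x y with y Fin.≟ p
    ... | yes ≡.refl = begin
      M (suc x) (punchIn (inject₁ y) y)  ≡⟨ ≡.cong (M (suc x)) (punchIn-inject₁-self y) ⟩
      M (suc x) (suc y)                  ≈⟨ Mp≈Mp+1 (suc x) ⟨
      M (suc x) (inject₁ y)              ≡⟨ ≡.cong (M (suc x)) (punchIn-suc-self y) ⟨
      M (suc x) (punchIn (suc y) y)      ∎
    ... | no y≢p = reflexive (≡.cong (M (suc x)) (punchIn-inject₁≡punchIn-suc p y y≢p))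
    s+[-s]≈0 : ∀ s t → s * t + (- s) * t ≈ 0#
    s+[-s]≈0 = solve 2 (λ s t → s :* t :+ (:- s) :* t := 0ᴾ) refl
    cancel : laplaceTerm M (inject₁ p) + laplaceTerm M (suc p) ≈ 0#
    cancel = begin
      laplaceTerm M (inject₁ p) + (- sgn R p) * (M zero (suc p) * det R (suc k) (minor M zero (suc p)))
        ≈⟨ +-congˡ (*-cong (-‿cong (reflexive (≡.sym (sgn-inject₁ p))))
                           (*-cong (sym (Mp≈Mp+1 zero)) (det-cong (suc k) (λ x y → sym (minors≈ x y))))) ⟩
      laplaceTerm M (inject₁ p) + (- sgn R (inject₁ p)) * (M zero (inject₁ p) * det R (suc k) (minor M zero (inject₁ p)))
        ≈⟨ s+[-s]≈0 _ _ ⟩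
      0# ∎
    others≈0 : ∀ j → j ≢ inject₁ p → j ≢ suc p → laplaceTerm M j ≈ 0#
    others≈0 j j≢p j≢p+1 with punchIn-adjacent j p j≢p j≢p+1
    ... | q , e₁ , e₂ = trans (*-congˡ (*-congˡ minor≈0)) (trans (*-congˡ (zeroʳ _)) (zeroʳ _))
      where
      minor≈0 : det R (suc k) (minor M zero j) ≈ 0#
      minor≈0 = det-adjacent-equal-columns k (minor M zero j) q (λ x → begin
        M (suc x) (punchIn j (inject₁ q))  ≡⟨ ≡.cong (M (suc x)) e₁ ⟩
        M (suc x) (inject₁ p)              ≈⟨ Mp≈Mp+1 (suc x) ⟩
        M (suc x) (suc p)                  ≡⟨ ≡.cong (M (suc x)) e₂ ⟨
        M (suc x) (punchIn j (suc q))      ∎)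

  sgn-punchIn : ∀ {k} (p : Fin (suc (suc k))) (j q : Fin (suc k)) → punchIn (punchIn p j) q ≡ p →
                sgn R (punchIn p j) * sgn R q ≈ - (sgn R p * sgn R j)
  sgn-punchIn zero j zero _ = solve 1 (λ s → (:- s) :* 1ᴾ := :- (1ᴾ :* s)) refl (sgn R j)
  sgn-punchIn (suc p) zero q ≡.refl = solve 1 (λ s → 1ᴾ :* s := :- ((:- s) :* 1ᴾ)) refl (sgn R q)
  sgn-punchIn {suc k} (suc p) (suc j) (suc q) e = begin
    (- sgn R (punchIn p j)) * (- sgn R q)   ≈⟨ [-x][-y]≈xy _ _ ⟩
    sgn R (punchIn p j) * sgn R q           ≈⟨ sgn-punchIn p j q (suc-injective e) ⟩
    - (sgn R p * sgn R j)                   ≈⟨ -‿cong ([-x][-y]≈xy _ _) ⟨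
    - ((- sgn R p) * (- sgn R j))           ∎
    where
    [-x][-y]≈xy : ∀ x y → (- x) * (- y) ≈ x * y
    [-x][-y]≈xy = solve 2 (λ x y → (:- x) :* (:- y) := x :* y) refl

  det-unit-column : ∀ k (M : Matrix R (suc k)) (r p : Fin (suc k)) → (∀ i → i ≢ r → M i p ≈ 0#) →
                    det R (suc k) M ≈ sgn R r * sgn R p * M r p * det R k (minor M r p)
  det-unit-column k M zero p Mp≈0 = begin
    det R (suc k) M                                          ≈⟨ sumF-remove k (laplaceTerm M) p ⟩
    laplaceTerm M p + sumF R k (laplaceTerm M ∘ punchIn p)   ≈⟨ +-congˡ (sumF-zero k _ others≈0) ⟩
    laplaceTerm M p + 0#                                     ≈⟨ regroup _ _ _ ⟩
    1# * sgn R p * M zero p * det R k (minor M zero p)       ∎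
    where
    regroup : ∀ s m d → s * (m * d) + 0# ≈ 1# * s * m * d
    regroup = solve 3 (λ s m d → s :* (m :* d) :+ 0ᴾ := 1ᴾ :* s :* m :* d) refl
    others≈0 : ∀ j → laplaceTerm M (punchIn p j) ≈ 0#
    others≈0 j = trans (*-congˡ (*-congˡ (det-zero-column k _ (punchOut j≢p) (λ x →
                   trans (reflexive (≡.cong (M (suc x)) (punchIn-punchOut j≢p))) (Mp≈0 (suc x) (λ ()))))))
                 (trans (*-congˡ (zeroʳ _)) (zeroʳ _))
      where
      j≢p : punchIn p j ≢ p
      j≢p = punchInᵢ≢i p j
  det-unit-column (suc k) M (suc r) p Mp≈0 = begin
    det R (suc (suc k)) M                                              ≈⟨ sumF-remove (suc k) (laplaceTerm M) p ⟩
    laplaceTerm M p + sumF R (suc k) (laplaceTerm M ∘ punchIn p)       ≈⟨ +-cong firstTerm≈0 (sumF-cong (suc k) others) ⟩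
    0# + sumF R (suc k) (λ j → scale * laplaceTerm T j)                    ≈⟨ +-identityˡ _ ⟩
    sumF R (suc k) (λ j → scale * laplaceTerm T j)                         ≈⟨ sumF-scale (suc k) scale (laplaceTerm T) ⟩
    scale * det R (suc k) T                                                ∎
    where
    T : Matrix R (suc k)
    T = minor M (suc r) p
    scale : Carrier
    scale = sgn R (suc r) * sgn R p * M (suc r) p
    firstTerm≈0 : laplaceTerm M p ≈ 0#
    firstTerm≈0 = trans (*-congˡ (*-congʳ (Mp≈0 zero (λ ())))) (trans (*-congˡ (zeroˡ _)) (zeroʳ _))
    regroup₁ : ∀ si sq m₀ sr mr d → si * (m₀ * (sr * sq * mr * d)) ≈ (si * sq) * (m₀ * sr * mr * d)
    regroup₁ = solve 6 (λ si sq m₀ sr mr d → si :* (m₀ :* (sr :* sq :* mr :* d)) := (si :* sq) :* (m₀ :* sr :* mr :* d)) refl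
    regroup₂ : ∀ sp sj m₀ sr mr d → (- (sp * sj)) * (m₀ * sr * mr * d) ≈ (- sr) * sp * mr * (sj * (m₀ * d))
    regroup₂ = solve 6 (λ sp sj m₀ sr mr d → (:- (sp :* sj)) :* (m₀ :* sr :* mr :* d) := (:- sr) :* sp :* mr :* (sj :* (m₀ :* d))) refl
    others : ∀ j → laplaceTerm M (punchIn p j) ≈ scale * laplaceTerm T j
    others j = begin
      sgn R i * (M zero i * det R (suc k) (minor M zero i))
        ≈⟨ *-congˡ (*-congˡ (det-unit-column k (minor M zero i) r q (λ x x≢r →
             trans (reflexive (≡.cong (M (suc x)) iq≡p)) (Mp≈0 (suc x) (x≢r ∘ suc-injective))))) ⟩
      sgn R i * (M zero i * (sgn R r * sgn R q * M (suc r) (punchIn i q) * det R k (minor (minor M zero i) r q)))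
        ≈⟨ regroup₁ _ _ _ _ _ _ ⟩
      (sgn R i * sgn R q) * (M zero i * sgn R r * M (suc r) (punchIn i q) * det R k (minor (minor M zero i) r q))
        ≈⟨ *-cong (sgn-punchIn p j q iq≡p)
                  (*-cong (*-congˡ (reflexive (≡.cong (M (suc r)) iq≡p)))
                          (det-cong k (λ x y → reflexive (≡.cong (M (suc (punchIn r x))) (punchIn-punchIn-comm p j q iq≡p y))))) ⟩
      (- (sgn R p * sgn R j)) * (M zero i * sgn R r * M (suc r) p * det R k (minor T zero j))
        ≈⟨ regroup₂ _ _ _ _ _ _ ⟩
      scale * laplaceTerm T j ∎
      where
      i : Fin (suc (suc k))
      i = punchIn p j
      q : Fin (suc k)
      q = punchOut (punchInᵢ≢i p j)
      iq≡p : punchIn i q ≡ p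
      iq≡p = punchIn-punchOut (punchInᵢ≢i p j)

  δ-refl : ∀ {k} (i : Fin k) → δ R i i ≡ 1#
  δ-refl i with i Fin.≟ i
  ... | yes _ = ≡.refl
  ... | no i≢i = ⊥-elim (i≢i ≡.refl)

  δ-≢ : ∀ {k} {i j : Fin k} → i ≢ j → δ R i j ≡ 0#
  δ-≢ {i = i} {j} i≢j with i Fin.≟ j
  ... | yes i≡j = ⊥-elim (i≢j i≡j)
  ... | no _ = ≡.refl

  δ-punchIn : ∀ {k} (c : Fin (suc k)) a b → δ R (punchIn c a) (punchIn c b) ≡ δ R a b
  δ-punchIn c a b with a Fin.≟ b
  ... | yes ≡.refl = δ-refl (punchIn c a)
  ... | no a≢b = δ-≢ (a≢b ∘ punchIn-injective c a b)

  δ-*-select : ∀ {k} (i p : Fin k) (f : Fin k → Carrier) → δ R i p * f i ≈ δ R i p * f p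
  δ-*-select i p f with i Fin.≟ p
  ... | yes ≡.refl = refl
  ... | no _ = trans (zeroˡ _) (sym (zeroˡ _))

  sgn-square : ∀ {k} (j : Fin k) → sgn R j * sgn R j ≈ 1#
  sgn-square zero = *-identityˡ 1#
  sgn-square (suc j) = trans (solve 1 (λ s → (:- s) :* (:- s) := s :* s) refl (sgn R j)) (sgn-square j)

  replaceColumn : ∀ {k} → Matrix R k → Fin k → (Fin k → Carrier) → Matrix R k
  replaceColumn M p v i j = if does (j Fin.≟ p) then v i else M i j

  replaceColumn-≡ : ∀ {k} (M : Matrix R k) p v i → replaceColumn M p v i p ≡ v i
  replaceColumn-≡ M p v i with p Fin.≟ p
  ... | yes _ = ≡.refl
  ... | no p≢p = ⊥-elim (p≢p ≡.refl)

  replaceColumn-≢ : ∀ {k} (M : Matrix R k) p v i {j} → j ≢ p → replaceColumn M p v i j ≡ M i j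
  replaceColumn-≢ M p v i {j} j≢p with j Fin.≟ p
  ... | yes j≡p = ⊥-elim (j≢p j≡p)
  ... | no _ = ≡.refl

  replaceColumn-≈ : ∀ {k} (M : Matrix R k) p u v i j → j ≢ p → replaceColumn M p u i j ≈ replaceColumn M p v i j
  replaceColumn-≈ M p u v i j j≢p = reflexive (≡.trans (replaceColumn-≢ M p u i j≢p) (≡.sym (replaceColumn-≢ M p v i j≢p)))

  det-replaceColumn-unit : ∀ k (M : Matrix R (suc k)) (r p : Fin (suc k)) →
    det R (suc k) (replaceColumn M p (λ i → δ R i r)) ≈ sgn R r * sgn R p * det R k (minor M r p)
  det-replaceColumn-unit k M r p = begin
    det R (suc k) U
      ≈⟨ det-unit-column k U r p (λ i i≢r → reflexive (≡.trans (replaceColumn-≡ M p unit i) (δ-≢ i≢r))) ⟩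
    sgn R r * sgn R p * U r p * det R k (minor U r p)
      ≡⟨ ≡.cong (λ u → sgn R r * sgn R p * u * det R k (minor U r p)) (≡.trans (replaceColumn-≡ M p unit r) (δ-refl r)) ⟩
    sgn R r * sgn R p * 1# * det R k (minor U r p)
      ≈⟨ *-cong (*-identityʳ _) (det-cong k (λ a b → reflexive (replaceColumn-≢ M p unit _ (punchInᵢ≢i p b)))) ⟩
    sgn R r * sgn R p * det R k (minor M r p) ∎
    where
    unit : Fin (suc k) → Carrier
    unit i = δ R i r
    U : Matrix R (suc k)
    U = replaceColumn M p unit

  det-subtract-adjacent-column : ∀ k (M : Matrix R (suc (suc k))) (p : Fin (suc k)) →
    det R (suc (suc k)) (replaceColumn M (inject₁ p) (λ i → M i (inject₁ p) - M i (suc p))) ≈ det R (suc (suc k)) M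
  det-subtract-adjacent-column k M p = begin
    det R K Z                              ≈⟨ det-linear-column K Z M Y C 1# (- 1#) Z≈M (replaceColumn-≈ M C difference next) columnC ⟩
    1# * det R K M + (- 1#) * det R K Y    ≈⟨ +-cong (*-identityˡ _) (trans (*-congˡ detY≈0) (zeroʳ _)) ⟩
    det R K M + 0#                         ≈⟨ +-identityʳ _ ⟩
    det R K M                              ∎
    where
    K : ℕ
    K = suc (suc k)
    C : Fin K
    C = inject₁ p
    difference next : Fin K → Carrier
    difference i = M i C - M i (suc p)
    next i = M i (suc p)
    Z Y : Matrix R K
    Z = replaceColumn M C difference
    Y = replaceColumn M C next
    Z≈M : ∀ i j → j ≢ C → Z i j ≈ M i j
    Z≈M i j j≢C = reflexive (replaceColumn-≢ M C difference i j≢C)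
    x-y≈1x+[-1]y : ∀ x y → x - y ≈ 1# * x + (- 1#) * y
    x-y≈1x+[-1]y = solve 2 (λ x y → x :- y := 1ᴾ :* x :+ (:- 1ᴾ) :* y) refl
    columnC : ∀ i → Z i C ≈ 1# * M i C + (- 1#) * Y i C
    columnC i = begin
      Z i C                                 ≡⟨ replaceColumn-≡ M C difference i ⟩
      M i C - M i (suc p)                   ≈⟨ x-y≈1x+[-1]y _ _ ⟩
      1# * M i C + (- 1#) * M i (suc p)     ≡⟨ ≡.cong (λ y → 1# * M i C + (- 1#) * y) (replaceColumn-≡ M C next i) ⟨
      1# * M i C + (- 1#) * Y i C           ∎
    p+1≢C : suc p ≢ C
    p+1≢C e = punchInᵢ≢i C p (≡.trans (punchIn-inject₁-self p) e)
    detY≈0 : det R K Y ≈ 0#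
    detY≈0 = det-adjacent-equal-columns (suc k) Y p (λ i →
      reflexive (≡.trans (replaceColumn-≡ M C next i) (≡.sym (replaceColumn-≢ M C next i p+1≢C))))

  det-twin-columns : ∀ k (M : Matrix R (suc (suc k))) (p : Fin (suc k)) e (w : Fin (suc (suc k)) → Carrier) →
    (∀ i → M i (inject₁ p) ≈ δ R i (inject₁ p) * e + w i) → (∀ i → M i (suc p) ≈ δ R i (suc p) * e + w i) →
    det R (suc (suc k)) M ≈ e * (det R (suc k) (minor M (inject₁ p) (inject₁ p)) + det R (suc k) (minor M (suc p) (inject₁ p)))
  det-twin-columns k M p e w MC≈ MD≈ = begin
    det R K M                                                              ≈⟨ det-subtract-adjacent-column k M p ⟨
    det R K Z                                                              ≈⟨ det-linear-column K Z U V C e (- e) (replaceColumn-≈ M C difference unitC)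
                                                                                     (replaceColumn-≈ M C difference unitD) columnC ⟩
    e * det R K U + (- e) * det R K V                                      ≈⟨ +-cong (*-congˡ (det-replaceColumn-unit (suc k) M C C))
                                                                                     (*-congˡ (det-replaceColumn-unit (suc k) M (suc p) C)) ⟩
    e * (sgn R C * sgn R C * dA) + (- e) * (sgn R (suc p) * sgn R C * dB)
                                                                           ≈⟨ +-congˡ (*-congˡ (*-congʳ (*-congʳ (-‿cong (reflexive (sgn-inject₁ p)))))) ⟨
    e * (sgn R C * sgn R C * dA) + (- e) * ((- sgn R C) * sgn R C * dB)    ≈⟨ collect _ _ _ _ ⟩
    (sgn R C * sgn R C) * (e * (dA + dB))                                  ≈⟨ trans (*-congʳ (sgn-square C)) (*-identityˡ _) ⟩
    e * (dA + dB)                                                          ∎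
    where
    K : ℕ
    K = suc (suc k)
    C : Fin K
    C = inject₁ p
    dA dB : Carrier
    dA = det R (suc k) (minor M C C)
    dB = det R (suc k) (minor M (suc p) C)
    difference unitC unitD : Fin K → Carrier
    difference i = M i C - M i (suc p)
    unitC i = δ R i C
    unitD i = δ R i (suc p)
    Z U V : Matrix R K
    Z = replaceColumn M C difference
    U = replaceColumn M C unitC
    V = replaceColumn M C unitD
    twinDifference : ∀ x y e w → (x * e + w) - (y * e + w) ≈ e * x + (- e) * y
    twinDifference = solve 4 (λ x y e w → (x :* e :+ w) :- (y :* e :+ w) := e :* x :+ (:- e) :* y) refl
    columnC : ∀ i → Z i C ≈ e * U i C + (- e) * V i C
    columnC i = begin
      Z i C                                    ≡⟨ replaceColumn-≡ M C difference i ⟩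
      M i C - M i (suc p)                      ≈⟨ +-cong (MC≈ i) (-‿cong (MD≈ i)) ⟩
      (unitC i * e + w i) - (unitD i * e + w i) ≈⟨ twinDifference _ _ _ _ ⟩
      e * unitC i + (- e) * unitD i
        ≡⟨ ≡.cong₂ (λ u v → e * u + (- e) * v) (replaceColumn-≡ M C unitC i) (replaceColumn-≡ M C unitD i) ⟨
      e * U i C + (- e) * V i C                 ∎
    collect : ∀ e s a b → e * (s * s * a) + (- e) * ((- s) * s * b) ≈ (s * s) * (e * (a + b))
    collect = solve 4 (λ e s a b → e :* (s :* s :* a) :+ (:- e) :* ((:- s) :* s :* b) := (s :* s) :* (e :* (a :+ b))) refl

  module PartMatrix {P : Set} (e : P → Carrier) (B : P → P → Carrier) where

    -- Vertex i lies in part π i and stands for w i vertices of the original graph.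
    partMatrix : ∀ {k} → (Fin k → P) → (Fin k → Carrier) → Matrix R k
    partMatrix π w i j = δ R i j * e (π i) + w i * B (π i) (π j)

    det-partMatrix-merge : ∀ k (p : Fin (suc k)) (π : Fin (suc (suc k)) → P) (w : Fin (suc (suc k)) → Carrier)
                             (π′ : Fin (suc k) → P) (w′ : Fin (suc k) → Carrier) →
      π (inject₁ p) ≡ π (suc p) → (∀ a → π′ a ≡ π (punchIn (inject₁ p) a)) →
      w′ p ≈ w (inject₁ p) + w (suc p) → (∀ a → a ≢ p → w′ a ≈ w (punchIn (inject₁ p) a)) →
      det R (suc (suc k)) (partMatrix π w) ≈ e (π (suc p)) * det R (suc k) (partMatrix π′ w′)
    -- The two minors left by det-twin-columns differ only in row p, and there they add up to the
    -- row of the merged vertex.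
    det-partMatrix-merge k p π w π′ w′ πC≡πD π′≡ w′p≈ w′≈ = begin
      det R (suc (suc k)) M                                        ≈⟨ det-twin-columns k M p (e (π D)) W (twin C πC≡πD) (twin D ≡.refl) ⟩
      e (π D) * (det R (suc k) (minor M C C) + det R (suc k) (minor M D C))
        ≈⟨ *-congˡ (trans (sym (+-cong (*-identityˡ _) (*-identityˡ _)))
                          (sym (det-linear-row (suc k) N (minor M C C) (minor M D C) p 1# 1# N≈A N≈B rowP))) ⟩
      e (π D) * det R (suc k) N                                    ∎
      where
      C D : Fin (suc (suc k))
      C = inject₁ p
      D = suc p
      M : Matrix R (suc (suc k))
      M = partMatrix π w
      N : Matrix R (suc k)
      N = partMatrix π′ w′
      W : Fin (suc (suc k)) → Carrier
      W i = w i * B (π i) (π D)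
      twin : ∀ j → π j ≡ π D → ∀ i → M i j ≈ δ R i j * e (π D) + W i
      twin j πj≡πD i = trans (+-congʳ (δ-*-select i j (e ∘ π))) (reflexive (≡.cong (λ x → δ R i j * e x + w i * B (π i) x) πj≡πD))
      N≈A : ∀ a b → a ≢ p → N a b ≈ minor M C C a b
      N≈A a b a≢p = begin
        δ R a b * e (π′ a) + w′ a * B (π′ a) (π′ b)
          ≡⟨ ≡.cong₂ (λ x y → δ R a b * e x + w′ a * B x y) (π′≡ a) (π′≡ b) ⟩
        δ R a b * e (π (punchIn C a)) + w′ a * B (π (punchIn C a)) (π (punchIn C b))
          ≈⟨ +-cong (*-congʳ (reflexive (≡.sym (δ-punchIn C a b)))) (*-congʳ (w′≈ a a≢p)) ⟩
        minor M C C a b ∎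
      N≈B : ∀ a b → a ≢ p → N a b ≈ minor M D C a b
      N≈B a b a≢p = trans (N≈A a b a≢p) (reflexive (≡.cong (λ i → M i (punchIn C b)) (punchIn-inject₁≡punchIn-suc p a a≢p)))
      splitWeight : ∀ d x u v y z → d * x + (u + v) * y ≈ 1# * (d * x + v * y) + 1# * (0# * z + u * y)
      splitWeight = solve 6 (λ d x u v y z → d :* x :+ (u :+ v) :* y
                                := 1ᴾ :* (d :* x :+ v :* y) :+ 1ᴾ :* (0ᴾ :* z :+ u :* y)) refl
      rowP : ∀ b → N p b ≈ 1# * minor M C C p b + 1# * minor M D C p b
      rowP b = begin
        δ R p b * e (π′ p) + w′ p * B (π′ p) (π′ b)
          ≡⟨ ≡.cong₂ (λ x y → δ R p b * e x + w′ p * B x y) (≡.trans (π′≡ p) (≡.cong π Cp≡D)) (π′≡ b) ⟩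
        δ R p b * e (π D) + w′ p * B (π D) (π b′)
          ≈⟨ +-cong (*-congʳ (reflexive (≡.trans (≡.sym (δ-punchIn C p b)) (≡.cong (λ i → δ R i b′) Cp≡D)))) (*-congʳ w′p≈) ⟩
        δ R D b′ * e (π D) + (w C + w D) * B (π D) (π b′)
          ≈⟨ splitWeight _ _ _ _ _ (e (π C)) ⟩
        1# * M D b′ + 1# * (0# * e (π C) + w C * B (π D) (π b′))
          ≡⟨ ≡.cong₂ (λ x y → 1# * M D b′ + 1# * (x * e (π C) + w C * B y (π b′)))
                     (≡.sym (δ-≢ (punchInᵢ≢i C b ∘ ≡.sym))) (≡.sym πC≡πD) ⟩
        1# * M D b′ + 1# * M C b′
          ≡⟨ ≡.cong₂ (λ i j → 1# * M i b′ + 1# * M j b′) (≡.sym Cp≡D) (≡.sym (punchIn-suc-self p)) ⟩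
        1# * minor M C C p b + 1# * minor M D C p b ∎
        where
        b′ : Fin (suc (suc k))
        b′ = punchIn C b
        Cp≡D : punchIn C p ≡ D
        Cp≡D = punchIn-inject₁-self p

    det-partMatrix-weights : ∀ k (π : Fin k → P) {w w′ : Fin k → Carrier} → (∀ i → w i ≈ w′ i) →
                             det R k (partMatrix π w) ≈ det R k (partMatrix π w′)
    det-partMatrix-weights k π w≈w′ = det-cong k (λ i j → +-congˡ (*-congʳ (w≈w′ i)))

  _+ᴾ_ : ∀ {n} → ℕ → Polynomial n → Polynomial n
  zero +ᴾ p = p
  suc k +ᴾ p = 1ᴾ :+ (k +ᴾ p)

  infixr 8 _+ᴾ_

  -- det, sgn and sumF transcribed into the solver's syntax: ⟦ detᴾ 3 N ⟧ is definitionally det R 3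
  -- of the evaluated entries, which lets the solver evaluate a concrete 3 × 3 determinant.
  sumᴾ : ∀ {n} k → (Fin k → Polynomial n) → Polynomial n
  sumᴾ zero f = 0ᴾ
  sumᴾ (suc k) f = f zero :+ sumᴾ k (f ∘ suc)

  sgnᴾ : ∀ {n k} → Fin k → Polynomial n
  sgnᴾ zero = 1ᴾ
  sgnᴾ (suc j) = :- sgnᴾ j

  detᴾ : ∀ {n} k → (Fin k → Fin k → Polynomial n) → Polynomial n
  detᴾ zero N = 1ᴾ
  detᴾ (suc k) N = sumᴾ (suc k) (λ j → sgnᴾ j :* (N zero j :* detᴾ k (λ r s → N (suc r) (punchIn j s))))

  pow-cong : ∀ n {u v} → u ≈ v → pow R u n ≈ pow R v n
  pow-cong zero u≈v = refl
  pow-cong (suc n) u≈v = *-cong u≈v (pow-cong n u≈v)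

  -- After contracting the shared edge, u and v are the weights of the vertices into which the
  -- K_m-only and the K_n-only vertices are merged one at a time.
  weights : Carrier → Carrier → ℕ → Carrier
  weights u v = (1# + 1#) ◃ u ◃ v ◃ (λ _ → 1#)

  weights-cong : ∀ {u u′ v v′} → u ≈ u′ → v ≈ v′ → ∀ t → weights u v t ≈ weights u′ v′ t
  weights-cong u≈u′ v≈v′ zero = refl
  weights-cong u≈u′ v≈v′ (suc zero) = u≈u′
  weights-cong u≈u′ v≈v′ (suc (suc zero)) = v≈v′
  weights-cong u≈u′ v≈v′ (suc (suc (suc t))) = refl

  module EquitablePartition (a b : ℕ) (α x : Carrier) where

    partDiagonal : Part → Carrier
    partDiagonal π = x - α * fromℕ R (partDegree a b π) + (1# - α)

    partCoupling : Part → Part → Carrier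
    partCoupling π ρ = if adjacentParts π ρ then - (1# - α) else 0#

    open PartMatrix partDiagonal partCoupling

    glued : Graph (suc (a ℕ.+ suc (suc (suc b))))
    glued = KmK2Kn (suc (suc (suc a))) (suc (suc (suc b)))

    characteristicMatrix≈partMatrix : ∀ i j →
      x * δ R i j - Aα R α glued i j ≈ partMatrix (vertexPart a ∘ toℕ) (λ _ → 1#) i j
    characteristicMatrix≈partMatrix i j = entry (does (i Fin.≟ j)) (adjMat R glued i j) sameVertex
      (≡.cong (λ t → if not (does (i Fin.≟ j)) ∧ t then 1# else 0#) (commonClique≡adjacentParts a i j))
      where
      π ρ : Part
      π = vertexPart a (toℕ i)
      ρ = vertexPart a (toℕ j)
      sameVertex : does (i Fin.≟ j) ≡ true → adjacentParts π ρ ≡ true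
      sameVertex with i Fin.≟ j
      ... | yes ≡.refl = λ _ → adjacentParts-refl π
      ... | no _ = λ ()
      diagonalIdentity : ∀ x α d → x * 1# - (α * d + (1# - α) * 0#) ≈ 1# * (x - α * d + (1# - α)) + 1# * (- (1# - α))
      diagonalIdentity = solve 3 (λ x α d → x :* 1ᴾ :- (α :* d :+ (1ᴾ :- α) :* 0ᴾ)
                                   := 1ᴾ :* (x :- α :* d :+ (1ᴾ :- α)) :+ 1ᴾ :* (:- (1ᴾ :- α))) refl
      offDiagonalIdentity : ∀ t → x * 0# - (α * 0# + (1# - α) * (if t then 1# else 0#)) ≈ 0# * partDiagonal π + 1# * (if t then - (1# - α) else 0#)
      offDiagonalIdentity true = solve 3 (λ x α e → x :* 0ᴾ :- (α :* 0ᴾ :+ (1ᴾ :- α) :* 1ᴾ)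
                                          := 0ᴾ :* e :+ 1ᴾ :* (:- (1ᴾ :- α))) refl x α (partDiagonal π)
      offDiagonalIdentity false = solve 3 (λ x α e → x :* 0ᴾ :- (α :* 0ᴾ :+ (1ᴾ :- α) :* 0ᴾ)
                                           := 0ᴾ :* e :+ 1ᴾ :* 0ᴾ) refl x α (partDiagonal π)
      entry : ∀ s A → (s ≡ true → adjacentParts π ρ ≡ true) → A ≡ (if not s ∧ adjacentParts π ρ then 1# else 0#) →
              x * (if s then 1# else 0#) - (α * (if s then fromℕ R (degree glued i) else 0#) + (1# - α) * A)
                ≈ (if s then 1# else 0#) * partDiagonal π + 1# * partCoupling π ρ
      entry true A same A≡0 = begin
        x * 1# - (α * fromℕ R (degree glued i) + (1# - α) * A)
          ≡⟨ ≡.cong₂ (λ d c → x * 1# - (α * fromℕ R d + (1# - α) * c)) (degree-KmK2Kn a b i) A≡0 ⟩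
        x * 1# - (α * fromℕ R (partDegree a b π) + (1# - α) * 0#)  ≈⟨ diagonalIdentity _ _ _ ⟩
        1# * partDiagonal π + 1# * (- (1# - α))
          ≡⟨ ≡.cong (λ t → 1# * partDiagonal π + 1# * (if t then - (1# - α) else 0#)) (same ≡.refl) ⟨
        1# * partDiagonal π + 1# * partCoupling π ρ                 ∎
      entry false A _ A≡ = begin
        x * 0# - (α * 0# + (1# - α) * A)                                             ≡⟨ ≡.cong (λ c → x * 0# - (α * 0# + (1# - α) * c)) A≡ ⟩
        x * 0# - (α * 0# + (1# - α) * (if adjacentParts π ρ then 1# else 0#))       ≈⟨ offDiagonalIdentity (adjacentParts π ρ) ⟩
        0# * partDiagonal π + 1# * partCoupling π ρ                                  ∎

    det-contract-shared-edge :
      det R (suc (a ℕ.+ suc (suc (suc b)))) (partMatrix (vertexPart a ∘ toℕ) (λ _ → 1#))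
        ≈ partDiagonal shared * det R (suc (suc (suc (a ℕ.+ b)))) (partMatrix (contractedPart a ∘ toℕ) (weights 1# 1# ∘ toℕ))
    det-contract-shared-edge = begin
      det R (suc (a ℕ.+ suc (suc (suc b)))) (partMatrix (vertexPart a ∘ toℕ) (λ _ → 1#))
        ≡⟨ ≡.cong (λ k → det R k (partMatrix (vertexPart a ∘ toℕ) (λ _ → 1#))) size≡ ⟩
      det R (suc (suc (suc (suc (a ℕ.+ b))))) (partMatrix (vertexPart a ∘ toℕ) (λ _ → 1#))
        ≈⟨ det-partMatrix-merge (suc (suc (a ℕ.+ b))) zero (vertexPart a ∘ toℕ) (λ _ → 1#) (contractedPart a ∘ toℕ) (weights 1# 1# ∘ toℕ)
             ≡.refl (λ _ → ≡.refl) refl otherWeights ⟩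
      partDiagonal shared * det R (suc (suc (suc (a ℕ.+ b)))) (partMatrix (contractedPart a ∘ toℕ) (weights 1# 1# ∘ toℕ)) ∎
      where
      size≡ : suc (a ℕ.+ suc (suc (suc b))) ≡ suc (suc (suc (suc (a ℕ.+ b))))
      size≡ = ≡.cong suc (≡.trans (ℕ.+-suc a _) (≡.cong suc (≡.trans (ℕ.+-suc a _) (≡.cong suc (ℕ.+-suc a b)))))
      otherWeights : ∀ y → y ≢ zero → weights 1# 1# (toℕ y) ≈ 1#
      otherWeights zero 0≢0 = ⊥-elim (0≢0 ≡.refl)
      otherWeights (suc zero) _ = refl
      otherWeights (suc (suc zero)) _ = refl
      otherWeights (suc (suc (suc y))) _ = refl

    det-collapse-mOnly : ∀ a′ u →
      det R (suc (suc (suc (a′ ℕ.+ b)))) (partMatrix (contractedPart a′ ∘ toℕ) (weights u 1# ∘ toℕ))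
        ≈ pow R (partDiagonal mOnly) a′ * det R (suc (suc (suc b))) (partMatrix (contractedPart 0 ∘ toℕ) (weights (u + fromℕ R a′) 1# ∘ toℕ))
    det-collapse-mOnly zero u = begin
      det R (suc (suc (suc b))) (partMatrix (contractedPart 0 ∘ toℕ) (weights u 1# ∘ toℕ))
        ≈⟨ det-partMatrix-weights (suc (suc (suc b))) (contractedPart 0 ∘ toℕ) (weights-cong (sym (+-identityʳ u)) (refl {1#}) ∘ toℕ) ⟩
      det R (suc (suc (suc b))) (partMatrix (contractedPart 0 ∘ toℕ) (weights (u + 0#) 1# ∘ toℕ))
        ≈⟨ *-identityˡ _ ⟨
      1# * det R (suc (suc (suc b))) (partMatrix (contractedPart 0 ∘ toℕ) (weights (u + 0#) 1# ∘ toℕ)) ∎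
    det-collapse-mOnly (suc a′) u = begin
      det R (suc (suc (suc (suc a′ ℕ.+ b)))) (partMatrix (contractedPart (suc a′) ∘ toℕ) (weights u 1# ∘ toℕ))
        ≈⟨ det-partMatrix-merge (suc (suc (a′ ℕ.+ b))) (suc zero) (contractedPart (suc a′) ∘ toℕ) (weights u 1# ∘ toℕ)
                                (contractedPart a′ ∘ toℕ) (weights (u + 1#) 1# ∘ toℕ)
             ≡.refl shiftedParts refl shiftedWeights ⟩
      e * det R (suc (suc (suc (a′ ℕ.+ b)))) (partMatrix (contractedPart a′ ∘ toℕ) (weights (u + 1#) 1# ∘ toℕ))
        ≈⟨ *-congˡ (det-collapse-mOnly a′ (u + 1#)) ⟩
      e * (pow R e a′ * det R (suc (suc (suc b))) (partMatrix (contractedPart 0 ∘ toℕ) (weights (u + 1# + fromℕ R a′) 1# ∘ toℕ)))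
        ≈⟨ *-assoc _ _ _ ⟨
      pow R e (suc a′) * det R (suc (suc (suc b))) (partMatrix (contractedPart 0 ∘ toℕ) (weights (u + 1# + fromℕ R a′) 1# ∘ toℕ))
        ≈⟨ *-congˡ (det-partMatrix-weights (suc (suc (suc b))) (contractedPart 0 ∘ toℕ)
                                           (weights-cong (+-assoc u 1# (fromℕ R a′)) (refl {1#}) ∘ toℕ)) ⟩
      pow R e (suc a′) * det R (suc (suc (suc b))) (partMatrix (contractedPart 0 ∘ toℕ) (weights (u + fromℕ R (suc a′)) 1# ∘ toℕ)) ∎
      where
      e : Carrier
      e = partDiagonal mOnly
      shiftedParts : ∀ y → contractedPart a′ (toℕ y) ≡ contractedPart (suc a′) (toℕ (punchIn (suc zero) y))
      shiftedParts zero = ≡.refl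
      shiftedParts (suc y) = ≡.refl
      shiftedWeights : ∀ y → y ≢ suc zero → weights (u + 1#) 1# (toℕ y) ≈ weights u 1# (toℕ (punchIn (suc zero) y))
      shiftedWeights zero _ = refl
      shiftedWeights (suc zero) 1≢1 = ⊥-elim (1≢1 ≡.refl)
      shiftedWeights (suc (suc zero)) _ = refl
      shiftedWeights (suc (suc (suc y))) _ = refl

    det-collapse-nOnly : ∀ b′ u v →
      det R (suc (suc (suc b′))) (partMatrix (contractedPart 0 ∘ toℕ) (weights u v ∘ toℕ))
        ≈ pow R (partDiagonal nOnly) b′ * det R 3 (partMatrix (contractedPart 0 ∘ toℕ) (weights u (v + fromℕ R b′) ∘ toℕ))
    det-collapse-nOnly zero u v = begin
      det R 3 (partMatrix (contractedPart 0 ∘ toℕ) (weights u v ∘ toℕ))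
        ≈⟨ det-partMatrix-weights 3 (contractedPart 0 ∘ toℕ) (weights-cong (refl {u}) (sym (+-identityʳ v)) ∘ toℕ) ⟩
      det R 3 (partMatrix (contractedPart 0 ∘ toℕ) (weights u (v + 0#) ∘ toℕ))
        ≈⟨ *-identityˡ _ ⟨
      1# * det R 3 (partMatrix (contractedPart 0 ∘ toℕ) (weights u (v + 0#) ∘ toℕ)) ∎
    det-collapse-nOnly (suc b′) u v = begin
      det R (suc (suc (suc (suc b′)))) (partMatrix (contractedPart 0 ∘ toℕ) (weights u v ∘ toℕ))
        ≈⟨ det-partMatrix-merge (suc (suc b′)) (suc (suc zero)) (contractedPart 0 ∘ toℕ) (weights u v ∘ toℕ)
                                (contractedPart 0 ∘ toℕ) (weights u (v + 1#) ∘ toℕ)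
             ≡.refl shiftedParts refl shiftedWeights ⟩
      e * det R (suc (suc (suc b′))) (partMatrix (contractedPart 0 ∘ toℕ) (weights u (v + 1#) ∘ toℕ))
        ≈⟨ *-congˡ (det-collapse-nOnly b′ u (v + 1#)) ⟩
      e * (pow R e b′ * det R 3 (partMatrix (contractedPart 0 ∘ toℕ) (weights u (v + 1# + fromℕ R b′) ∘ toℕ)))
        ≈⟨ *-assoc _ _ _ ⟨
      pow R e (suc b′) * det R 3 (partMatrix (contractedPart 0 ∘ toℕ) (weights u (v + 1# + fromℕ R b′) ∘ toℕ))
        ≈⟨ *-congˡ (det-partMatrix-weights 3 (contractedPart 0 ∘ toℕ) (weights-cong (refl {u}) (+-assoc v 1# (fromℕ R b′)) ∘ toℕ)) ⟩
      pow R e (suc b′) * det R 3 (partMatrix (contractedPart 0 ∘ toℕ) (weights u (v + fromℕ R (suc b′)) ∘ toℕ)) ∎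
      where
      e : Carrier
      e = partDiagonal nOnly
      shiftedParts : ∀ y → contractedPart 0 (toℕ y) ≡ contractedPart 0 (toℕ (punchIn (suc (suc zero)) y))
      shiftedParts zero = ≡.refl
      shiftedParts (suc zero) = ≡.refl
      shiftedParts (suc (suc y)) = ≡.refl
      shiftedWeights : ∀ y → y ≢ suc (suc zero) → weights u (v + 1#) (toℕ y) ≈ weights u v (toℕ (punchIn (suc (suc zero)) y))
      shiftedWeights zero _ = refl
      shiftedWeights (suc zero) _ = refl
      shiftedWeights (suc (suc zero)) 2≢2 = ⊥-elim (2≢2 ≡.refl)
      shiftedWeights (suc (suc (suc y))) _ = refl

    cubicFactor : Carrier → Carrier → Carrier → Carrier
    cubicFactor s t u =
      (x - fromℕ R (suc (suc (suc a))) + fromℕ R 3 - fromℕ R 2 * α) * (x - fromℕ R (suc (suc (suc b))) + fromℕ R 3 - fromℕ R 2 * α)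
        * (x - α * s - 1#)
      - fromℕ R 2 * pow R (1# - α) 2 * (s * x - fromℕ R 2 * α * s - t - u)

    cubicFactor-cong : ∀ {s s′ t t′ u u′} → s ≈ s′ → t ≈ t′ → u ≈ u′ → cubicFactor s t u ≈ cubicFactor s′ t′ u′
    cubicFactor-cong s≈ t≈ u≈ =
      +-cong (*-congˡ (+-congʳ (+-congˡ (-‿cong (*-congˡ s≈)))))
             (-‿cong (*-congˡ (+-cong (+-cong (+-cong (*-congʳ s≈) (-‿cong (*-congˡ s≈))) (-‿cong t≈)) (-‿cong u≈))))

    cubic : Carrier
    cubic = cubicFactor (fromℕ R a + (1# + (1# + fromℕ R b))) ((1# + fromℕ R a) * fromℕ R b) (fromℕ R a * (1# + fromℕ R b))

    det-quotient :
      det R 3 (partMatrix (contractedPart 0 ∘ toℕ) (weights (1# + fromℕ R a) (1# + fromℕ R b) ∘ toℕ))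
        ≈ cubic
    det-quotient = begin
      det R 3 (partMatrix π w)                      ≈⟨ det-cong 3 entries≈ ⟩
      det R 3 (PartMatrix.partMatrix explicitDiagonal partCoupling π w)
        ≈⟨ solve 4 (λ X A Fa Fb → detᴾ 3 (entryᴾ X A Fa Fb) := cubicᴾ X A Fa Fb) refl x α (fromℕ R a) (fromℕ R b) ⟩
      cubic ∎
      where
      π : Fin 3 → Part
      π = contractedPart 0 ∘ toℕ
      w : Fin 3 → Carrier
      w = weights (1# + fromℕ R a) (1# + fromℕ R b) ∘ toℕ
      degreeValue : Part → Carrier
      degreeValue shared = fromℕ R a + (1# + (1# + (1# + fromℕ R b)))
      degreeValue mOnly = 1# + (1# + fromℕ R a)
      degreeValue nOnly = 1# + (1# + fromℕ R b)
      degree≈ : ∀ ρ → fromℕ R (partDegree a b ρ) ≈ degreeValue ρ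
      degree≈ shared = fromℕ-+ a (suc (suc (suc b)))
      degree≈ mOnly = refl
      degree≈ nOnly = refl
      explicitDiagonal : Part → Carrier
      explicitDiagonal ρ = x - α * degreeValue ρ + (1# - α)
      diagonal≈ : ∀ ρ → partDiagonal ρ ≈ explicitDiagonal ρ
      diagonal≈ ρ = +-congʳ (+-congˡ (-‿cong (*-congˡ (degree≈ ρ))))
      entries≈ : ∀ i j → partMatrix π w i j ≈ PartMatrix.partMatrix explicitDiagonal partCoupling π w i j
      entries≈ i j = +-congʳ (*-congˡ (diagonal≈ (π i)))
      entryᴾ : (X A Fa Fb : Polynomial 4) → Fin 3 → Fin 3 → Polynomial 4
      entryᴾ X A Fa Fb i j = (if does (i Fin.≟ j) then 1ᴾ else 0ᴾ) :* (X :- A :* degreeᴾ (π i) :+ (1ᴾ :- A))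
                             :+ ((1ᴾ :+ 1ᴾ) ◃ (1ᴾ :+ Fa) ◃ (1ᴾ :+ Fb) ◃ (λ _ → 1ᴾ)) (toℕ i) :* couplingᴾ (π i) (π j)
        where
        degreeᴾ : Part → Polynomial 4
        degreeᴾ shared = Fa :+ (3 +ᴾ Fb)
        degreeᴾ mOnly = 2 +ᴾ Fa
        degreeᴾ nOnly = 2 +ᴾ Fb
        couplingᴾ : Part → Part → Polynomial 4
        couplingᴾ ρ σ = if adjacentParts ρ σ then :- (1ᴾ :- A) else 0ᴾ
      cubicᴾ : (X A Fa Fb : Polynomial 4) → Polynomial 4
      cubicᴾ X A Fa Fb =
        (X :- (3 +ᴾ Fa) :+ (3 +ᴾ 0ᴾ) :- (2 +ᴾ 0ᴾ) :* A) :* (X :- (3 +ᴾ Fb) :+ (3 +ᴾ 0ᴾ) :- (2 +ᴾ 0ᴾ) :* A) :* (X :- A :* s :- 1ᴾ)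
        :- (2 +ᴾ 0ᴾ) :* ((1ᴾ :- A) :* ((1ᴾ :- A) :* 1ᴾ)) :* (s :* X :- (2 +ᴾ 0ᴾ) :* A :* s :- (1ᴾ :+ Fa) :* Fb :- Fa :* (1ᴾ :+ Fb))
        where
        s : Polynomial 4
        s = Fa :+ (2 +ᴾ Fb)

    rhs15-factors : rhs15 R (suc (suc (suc a))) (suc (suc (suc b))) α x
      ≈ partDiagonal shared * (pow R (partDiagonal mOnly) a * (pow R (partDiagonal nOnly) b
          * cubic))
    rhs15-factors = trans (*-cong (*-cong (*-cong (pow-cong a (shiftDegree _)) (pow-cong b (shiftDegree _))) (shiftDegree _))
                                  (cubicFactor-cong s≈ (fromℕ-* (suc a) b) (fromℕ-* a (suc b))))
                          (regroup _ _ _ _)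
      where
      shiftDegree : ∀ d → x - α * (1# + d) + 1# ≈ x - α * d + (1# - α)
      shiftDegree = solve 3 (λ x α d → x :- α :* (1ᴾ :+ d) :+ 1ᴾ := x :- α :* d :+ (1ᴾ :- α)) refl x α
      s≈ : fromℕ R (a ℕ.+ suc (suc (suc b)) ℕ.∸ 1) ≈ fromℕ R a + (1# + (1# + fromℕ R b))
      s≈ = trans (reflexive (≡.cong (λ k → fromℕ R (k ℕ.∸ 1)) (ℕ.+-suc a (suc (suc b))))) (fromℕ-+ a (suc (suc b)))
      regroup : ∀ p q s c → p * q * s * c ≈ s * (p * (q * c))
      regroup = solve 4 (λ p q s c → p :* q :* s :* c := s :* (p :* (q :* c))) refl

mainTheorem15 : {c ℓ : Level} (R : CommutativeRing c ℓ) (m n : ℕ) → 2 < m → 2 < n →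
                (α x : CommutativeRing.Carrier R) →
                CommutativeRing._≈_ R (Φ R (Aα R α (KmK2Kn m n)) x) (rhs15 R m n α x)
mainTheorem15 R (suc (suc (suc a))) (suc (suc (suc b))) (s≤s (s≤s (s≤s z≤n))) (s≤s (s≤s (s≤s z≤n))) α x = begin
  Φ R (Aα R α glued) x
    ≈⟨ det-cong R (suc (a ℕ.+ suc (suc (suc b)))) characteristicMatrix≈partMatrix ⟩
  det R (suc (a ℕ.+ suc (suc (suc b)))) (partMatrix (vertexPart a ∘ toℕ) (λ _ → 1#))
    ≈⟨ det-contract-shared-edge ⟩
  eS * det R (suc (suc (suc (a ℕ.+ b)))) (partMatrix (contractedPart a ∘ toℕ) (weights R 1# 1# ∘ toℕ))
    ≈⟨ *-congˡ (det-collapse-mOnly a 1#) ⟩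
  eS * (pow R eM a * det R (suc (suc (suc b))) (partMatrix (contractedPart 0 ∘ toℕ) (weights R (1# + fromℕ R a) 1# ∘ toℕ)))
    ≈⟨ *-congˡ (*-congˡ (det-collapse-nOnly b (1# + fromℕ R a) 1#)) ⟩
  eS * (pow R eM a * (pow R eN b * det R 3 (partMatrix (contractedPart 0 ∘ toℕ) (weights R (1# + fromℕ R a) (1# + fromℕ R b) ∘ toℕ))))
    ≈⟨ *-congˡ (*-congˡ (*-congˡ det-quotient)) ⟩
  eS * (pow R eM a * (pow R eN b * cubic))
    ≈⟨ rhs15-factors ⟨
  rhs15 R (suc (suc (suc a))) (suc (suc (suc b))) α x ∎
  where
  open CommutativeRing R
  open EquitablePartition R a b α x
  open PartMatrix R partDiagonal partCoupling
  open import Relation.Binary.Reasoning.Setoid setoid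
  eS eM eN : Carrier
  eS = partDiagonal shared
  eM = partDiagonal mOnly
  eN = partDiagonal nOnly
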